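{- Let $G$ be a critical graph. Then for every minimum vertex cover $C$ of $G$, there is no bridge of $G$ with both endvertices in $C$.
   Context: All graphs are finite and simple. A vertex cover of $G$ is a set $C \subseteq V(G)$ meeting every edge; $\tau(G)$ is the minimum size of a vertex cover, and a minimum vertex cover is one of size $\tau(G)$. A connected vertex cover of $G$ is a vertex cover $C$ such that $G[C]$ is connected (if $G$ is disconnected, $G[C]$ must have the same number of connected components as $G$); $\tau_c(G)$ is its minimum size. The price of connectivity of a graph with at least one edge is $\tau_c(G)/\tau(G)$. A graph $G$ is critical if the price of connectivity of every proper induced subgraph of $G$ is strictly smaller than that of $G$. A bridge is an edge whose removal increases the number of connected components. -}

module Defs where

open import Data.Nat using (ℕ; _≤_; _<_; _*_)
open import Data.Fin using (Fin; _≟_)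
open import Data.Fin.Subset using (Subset; _∈_; _∉_; _⊆_; ∣_∣; ⊤)
open import Data.Bool using (Bool; true; false; _∧_; _∨_; not)
open import Data.Product using (Σ; ∃; _×_; _,_; proj₁)
open import Relation.Binary.PropositionalEquality using (_≡_)
open import Relation.Nullary using (¬_)
open import Relation.Nullary.Decidable using (⌊_⌋)
open import Function using (Surjective)

record Graph (n : ℕ) : Set where
  field
    adj   : Fin n → Fin n → Bool
    sym   : ∀ u v → adj u v ≡ adj v u
    irrefl : ∀ u → adj u u ≡ false
open Graph public

module _ {n : ℕ} (G : Graph n) where

  IsVC : Subset n → Subset n → Set
  IsVC S C = C ⊆ S × (∀ u v → u ∈ S → v ∈ S → adj G u v ≡ true → u ∈ C Data.Sum.⊎ v ∈ C)
    where import Data.Sum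

  HasEdge : Subset n → Set
  HasEdge S = Σ (Fin n) λ u → Σ (Fin n) λ v → u ∈ S × v ∈ S × adj G u v ≡ true

  data Reach (S : Subset n) : Fin n → Fin n → Set where
    here : ∀ {u} → u ∈ S → Reach S u u
    step : ∀ {u w v} → u ∈ S → adj G u w ≡ true → Reach S w v → Reach S u v

  -- G[S] has exactly k connected components: there is a surjection from the
  -- vertices of G[S] onto Fin k identifying exactly the mutually reachable pairs.
  NumComponents : Subset n → ℕ → Set
  NumComponents S k =
    Σ (Σ (Fin n) (λ v → v ∈ S) → Fin k) λ f →
      Surjective _≡_ _≡_ f ×
      (∀ x y → (f x ≡ f y → Reach S (proj₁ x) (proj₁ y)) × (Reach S (proj₁ x) (proj₁ y) → f x ≡ f y))

  -- C is a connected vertex cover of G[S]: G[C] has as many components as G[S]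
  IsCVC : Subset n → Subset n → Set
  IsCVC S C = IsVC S C × Σ ℕ λ k → NumComponents S k × NumComponents C k

  IsMinVC : Subset n → Subset n → Set
  IsMinVC S C = IsVC S C × (∀ D → IsVC S D → ∣ C ∣ ≤ ∣ D ∣)

  IsMinCVC : Subset n → Subset n → Set
  IsMinCVC S C = IsCVC S C × (∀ D → IsCVC S D → ∣ C ∣ ≤ ∣ D ∣)

  IsTau : Subset n → ℕ → Set
  IsTau S t = Σ (Subset n) λ C → IsMinVC S C × ∣ C ∣ ≡ t

  IsTauC : Subset n → ℕ → Set
  IsTauC S t = Σ (Subset n) λ C → IsMinCVC S C × ∣ C ∣ ≡ t

  -- price(G[S]) < price(G), i.e. τc(S)/τ(S) < τc(G)/τ(G), written by
  -- cross-multiplication of the (positive) denominators.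
  PriceSmaller : Subset n → Set
  PriceSmaller S = ∀ t tc T Tc → IsTau S t → IsTauC S tc → IsTau ⊤ T → IsTauC ⊤ Tc →
                   tc * T < Tc * t

  -- G is critical: G has an edge, and every proper induced subgraph with at
  -- least one edge (so that its price is defined) has strictly smaller price.
  Critical : Set
  Critical = HasEdge ⊤ × (∀ S → (Σ (Fin n) λ v → v ∉ S) → HasEdge S → PriceSmaller S)

removeEdge : ∀ {n} → Graph n → Fin n → Fin n → Graph n
removeEdge {n} G u v = record
  { adj = a
  ; sym = λ x y → symA x y
  ; irrefl = λ x → irr x }
  where
    isE : Fin n → Fin n → Bool
    isE x y = (⌊ x ≟ u ⌋ ∧ ⌊ y ≟ v ⌋) ∨ (⌊ x ≟ v ⌋ ∧ ⌊ y ≟ u ⌋)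
    a : Fin n → Fin n → Bool
    a x y = adj G x y ∧ not (isE x y)
    open import Relation.Binary.PropositionalEquality using (cong₂; refl)
    open import Data.Bool.Properties using (∧-comm; ∨-comm)
    isE-sym : ∀ x y → isE x y ≡ isE y x
    isE-sym x y rewrite ∧-comm ⌊ x ≟ u ⌋ ⌊ y ≟ v ⌋ | ∧-comm ⌊ x ≟ v ⌋ ⌊ y ≟ u ⌋ =
      ∨-comm (⌊ y ≟ v ⌋ ∧ ⌊ x ≟ u ⌋) (⌊ y ≟ u ⌋ ∧ ⌊ x ≟ v ⌋)
    symA : ∀ x y → a x y ≡ a y x
    symA x y = cong₂ (λ p q → p ∧ not q) (sym G x y) (isE-sym x y)
    irr : ∀ x → a x x ≡ false
    irr x rewrite irrefl G x = refl

IsBridge : ∀ {n} → Graph n → Fin n → Fin n → Set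
IsBridge G u v = adj G u v ≡ true ×
  Σ ℕ λ k → Σ ℕ λ k' → NumComponents G ⊤ k × NumComponents (removeEdge G u v) ⊤ k' × k < k'

-- Let uv be a bridge with both ends in a minimum vertex cover C. If u (say) has no other
-- neighbour, C − u is a smaller cover. Otherwise let B be the side of v in G − uv and cut G
-- along the bridge into G₁ = G[(V ∖ B) ∪ {v}] and G₂ = G[B ∪ {u}], proper induced subgraphs
-- that both contain uv. C ∖ B and C ∩ B cover G₁ and G₂, so τ(G₁) + τ(G₂) ≤ τ(G); minimum
-- connected covers D₁, D₂ of G₁, G₂ glue to the connected cover (D₁ ∖ B) ∪ (D₂ ∩ B) of G, so
-- τc(G) ≤ τc(G₁) + τc(G₂). Criticality gives τc(Gᵢ) τ(G) < τc(G) τ(Gᵢ); adding the two,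
-- τc(G₁) + τc(G₂) < τc(G), a contradiction.
--
-- Reachability, component counts and minimum covers are obtained by excluded middle inside the
-- double-negation monad, which is sound here because the goal is a negation.
module Submission where

open import Level using (0ℓ)
open import Data.Nat using (ℕ; zero; suc; _+_; _*_; _≤_; _<_; z≤n; s≤s)
open import Data.Nat.Properties
  using (≤-refl; ≤-reflexive; ≤-trans; ≤-pred; ≮⇒≥; <⇒≱; +-suc; +-comm; +-mono-≤; +-mono-<;
         *-monoʳ-≤; *-cancelʳ-<; *-distribʳ-+; *-distribˡ-+; n≤1+n; module ≤-Reasoning)
open import Data.Fin using (Fin; zero; suc; _≟_)
open import Data.Fin.Properties using (any?; suc-injective; injective⇒≤)
open import Data.Fin.Subset using (Subset; _∈_; _∉_; _⊆_; ∣_∣; ⊤; ∁; _∩_; _∪_; ⁅_⁆; _-_; inside; outside)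
open import Data.Fin.Subset.Properties
  using (_∈?_; ∈⊤; x∈⁅x⁆; x∈⁅y⁆⇒x≡y; x∈∁p⇒x∉p; x∉p⇒x∈∁p; x∉∁p⇒x∈p; x∈p∩q⁺; x∈p∩q⁻; x∈p∪q⁺; x∈p∪q⁻;
         ∣p∩q∣≤∣p∣; x∈p∧x≢y⇒x∈p-y; x∈p⇒∣p-x∣<∣p∣)
open import Data.Vec using ([]; _∷_; here; there)
open import Data.Bool using (true)
open import Data.Bool.Properties using () renaming (_≟_ to _≟ᵇ_)
open import Data.Product using (Σ; ∃; Σ-syntax; _×_; _,_; proj₁; proj₂)
open import Data.Sum using (_⊎_; inj₁; inj₂; swap)
open import Data.Empty using (⊥)
open import Effect.Monad using (RawMonad)
open import Function using (_∘_; Surjective; _⇔_; mk⇔; Equivalence)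
open import Function.Consequences.Propositional using (strictlySurjective⇒surjective)
open import Relation.Binary.PropositionalEquality using (_≡_; _≢_; refl; sym; trans; cong; subst; subst₂)
open import Relation.Nullary using (¬_; Dec; yes; no; ¬?; _×-dec_)
open import Relation.Nullary.Negation using (¬¬-Monad; contradiction)
open import Relation.Nullary.Decidable using (¬¬-excluded-middle)

open import Defs renaming (sym to adj-comm)

open RawMonad (¬¬-Monad {0ℓ}) using (_>>=_; pure)
open Equivalence using (to; from)

private
  variable
    n k : ℕ

¬¬-∀-Fin : {P : Fin n → Set} → (∀ i → ¬ ¬ P i) → ¬ ¬ (∀ i → P i)
¬¬-∀-Fin {zero}  _ ¬∀ = ¬∀ λ ()
¬¬-∀-Fin {suc n} h ¬∀ = h zero λ p₀ → ¬¬-∀-Fin (h ∘ suc) λ ps → ¬∀ λ { zero → p₀ ; (suc i) → ps i }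

¬¬-decidable : (P : Fin n → Set) → ¬ ¬ (∀ i → Dec (P i))
¬¬-decidable P = ¬¬-∀-Fin λ _ → ¬¬-excluded-middle

subset-of : {P : Fin n → Set} → (∀ i → Dec (P i)) → Σ[ B ∈ Subset n ] (∀ {i} → i ∈ B ⇔ P i)
subset-of {zero}  P? = [] , λ { {()} }
subset-of {suc n} P? with subset-of (P? ∘ suc) | P? zero
... | B , B-spec | yes p₀ = inside ∷ B , λ
  { {zero}  → mk⇔ (λ _ → p₀) (λ _ → here)
  ; {suc i} → mk⇔ (λ { (there i∈B) → to B-spec i∈B }) (there ∘ from B-spec) }
... | B , B-spec | no ¬p₀ = outside ∷ B , λ
  { {zero}  → mk⇔ (λ ()) (λ p₀ → contradiction p₀ ¬p₀)
  ; {suc i} → mk⇔ (λ { (there i∈B) → to B-spec i∈B }) (there ∘ from B-spec) }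

¬¬-subset : (P : Fin n → Set) → ¬ ¬ (Σ[ B ∈ Subset n ] (∀ {i} → i ∈ B ⇔ P i))
¬¬-subset P = do
  P? ← ¬¬-decidable P
  pure (subset-of P?)

∣p∩q∣+∣p∩∁q∣≡∣p∣ : (p q : Subset n) → ∣ p ∩ q ∣ + ∣ p ∩ ∁ q ∣ ≡ ∣ p ∣
∣p∩q∣+∣p∩∁q∣≡∣p∣ []            []            = refl
∣p∩q∣+∣p∩∁q∣≡∣p∣ (inside  ∷ p) (inside  ∷ q) = cong suc (∣p∩q∣+∣p∩∁q∣≡∣p∣ p q)
∣p∩q∣+∣p∩∁q∣≡∣p∣ (inside  ∷ p) (outside ∷ q) = trans (+-suc _ _) (cong suc (∣p∩q∣+∣p∩∁q∣≡∣p∣ p q))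
∣p∩q∣+∣p∩∁q∣≡∣p∣ (outside ∷ p) (_       ∷ q) = ∣p∩q∣+∣p∩∁q∣≡∣p∣ p q

∣p∪q∣≤∣p∣+∣q∣ : (p q : Subset n) → ∣ p ∪ q ∣ ≤ ∣ p ∣ + ∣ q ∣
∣p∪q∣≤∣p∣+∣q∣ []            []            = z≤n
∣p∪q∣≤∣p∣+∣q∣ (inside  ∷ p) (inside  ∷ q) =
  s≤s (≤-trans (∣p∪q∣≤∣p∣+∣q∣ p q) (≤-trans (n≤1+n _) (≤-reflexive (sym (+-suc _ _)))))
∣p∪q∣≤∣p∣+∣q∣ (inside  ∷ p) (outside ∷ q) = s≤s (∣p∪q∣≤∣p∣+∣q∣ p q)
∣p∪q∣≤∣p∣+∣q∣ (outside ∷ p) (inside  ∷ q) = ≤-trans (s≤s (∣p∪q∣≤∣p∣+∣q∣ p q)) (≤-reflexive (sym (+-suc _ _)))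
∣p∪q∣≤∣p∣+∣q∣ (outside ∷ p) (outside ∷ q) = ∣p∪q∣≤∣p∣+∣q∣ p q

IsMinimal : (Subset n → Set) → Subset n → Set
IsMinimal P X = P X × (∀ Y → P Y → ∣ X ∣ ≤ ∣ Y ∣)

¬¬-minimal : (P : Subset n → Set) {X : Subset n} → P X →
             ¬ ¬ (Σ[ Y ∈ Subset n ] IsMinimal P Y × ∣ Y ∣ ≤ ∣ X ∣)
¬¬-minimal {n} P {X} PX = descend ∣ X ∣ X PX ≤-refl
  where
  descend : ∀ m Y → P Y → ∣ Y ∣ ≤ m → ¬ ¬ (Σ[ Z ∈ Subset n ] IsMinimal P Z × ∣ Z ∣ ≤ m)
  descend zero Y PY ∣Y∣≤0 = pure (Y , (PY , λ _ _ → ≤-trans ∣Y∣≤0 z≤n) , ∣Y∣≤0)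
  descend (suc m) Y PY ∣Y∣≤m+1 = ¬¬-excluded-middle {A = ∃ λ Z → P Z × ∣ Z ∣ < ∣ Y ∣} >>= λ
    { (yes (Z , PZ , ∣Z∣<∣Y∣)) → do
        (W , W-min , ∣W∣≤m) ← descend m Z PZ (≤-pred (≤-trans ∣Z∣<∣Y∣ ∣Y∣≤m+1))
        pure (W , W-min , ≤-trans ∣W∣≤m (n≤1+n m))
    ; (no none-smaller) →
        pure (Y , (PY , λ Z PZ → ≮⇒≥ λ ∣Z∣<∣Y∣ → none-smaller (Z , PZ , ∣Z∣<∣Y∣)) , ∣Y∣≤m+1) }

module _ (G : Graph n) (S : Subset n) where

  ¬¬-τ : ∀ {X} → IsVC G S X → ¬ ¬ (∃ λ t → IsTau G S t × t ≤ ∣ X ∣)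
  ¬¬-τ X-vc = do
    (Y , Y-min , ∣Y∣≤∣X∣) ← ¬¬-minimal (IsVC G S) X-vc
    pure (∣ Y ∣ , (Y , Y-min , refl) , ∣Y∣≤∣X∣)

  ¬¬-τc : ∀ {X} → IsCVC G S X → ¬ ¬ (∃ λ t → IsTauC G S t × t ≤ ∣ X ∣)
  ¬¬-τc X-cvc = do
    (Y , Y-min , ∣Y∣≤∣X∣) ← ¬¬-minimal (IsCVC G S) X-cvc
    pure (∣ Y ∣ , (Y , Y-min , refl) , ∣Y∣≤∣X∣)

module _ (G : Graph n) where

  adj-sym : ∀ {x y} → adj G x y ≡ true → adj G y x ≡ true
  adj-sym {x} {y} e = trans (adj-comm G y x) e

  adj-irrefl : ∀ {x} → adj G x x ≢ true
  adj-irrefl {x} e with () ← trans (sym e) (irrefl G x)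

module _ {G : Graph n} {S : Subset n} where

  reach-start : ∀ {x y} → Reach G S x y → x ∈ S
  reach-start (here x∈S)     = x∈S
  reach-start (step x∈S _ _) = x∈S

  reach-trans : ∀ {x y z} → Reach G S x y → Reach G S y z → Reach G S x z
  reach-trans (here _)       r′ = r′
  reach-trans (step x∈S e r) r′ = step x∈S e (reach-trans r r′)

  reach-sym : ∀ {x y} → Reach G S x y → Reach G S y x
  reach-sym (here x∈S) = here x∈S
  reach-sym (step x∈S e r) =
    reach-trans (reach-sym r) (step (reach-start r) (adj-sym G e) (here x∈S))

  edge-reach : ∀ {x y} → x ∈ S → y ∈ S → adj G x y ≡ true → Reach G S x y
  edge-reach x∈S y∈S e = step x∈S e (here y∈S)

reach-map : {G G′ : Graph n} {S S′ : Subset n} (f : Fin n → Fin n) →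
            (∀ {x} → x ∈ S → f x ∈ S′) →
            (∀ {x y} → x ∈ S → y ∈ S → adj G x y ≡ true → Reach G′ S′ (f x) (f y)) →
            ∀ {x y} → Reach G S x y → Reach G′ S′ (f x) (f y)
reach-map f f-∈ f-edge (here x∈S)     = here (f-∈ x∈S)
reach-map f f-∈ f-edge (step x∈S e r) =
  reach-trans (f-edge x∈S (reach-start r) e) (reach-map f f-∈ f-edge r)

reach-mono : {G : Graph n} {S S′ : Subset n} → S ⊆ S′ → ∀ {x y} → Reach G S x y → Reach G S′ x y
reach-mono S⊆S′ = reach-map (λ x → x) S⊆S′ λ x∈S y∈S e → edge-reach (S⊆S′ x∈S) (S⊆S′ y∈S) e

Connected : Graph n → Subset n → Set
Connected G S = ∀ {x y} → x ∈ S → y ∈ S → Reach G S x y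

Classification : (Fin n → Set) → (Fin n → Fin n → Set) → ℕ → Set
Classification {n} P R k =
  Σ[ f ∈ (Σ (Fin n) P → Fin k) ] Surjective _≡_ _≡_ f ×
    (∀ x y → (f x ≡ f y → R (proj₁ x) (proj₁ y)) × (R (proj₁ x) (proj₁ y) → f x ≡ f y))

record IsEquivalenceOn (P : Fin n → Set) (R : Fin n → Fin n → Set) : Set where
  field
    domain     : ∀ {x y} → R x y → P x
    reflexive  : ∀ {x} → P x → R x x
    symmetric  : ∀ {x y} → R x y → R y x
    transitive : ∀ {x y z} → R x y → R y z → R x z

module Classify {P : Fin (suc n) → Set} {R : Fin (suc n) → Fin (suc n) → Set} where

  P⁺ : Fin n → Set
  P⁺ i = P (suc i)

  R⁺ : Fin n → Fin n → Set
  R⁺ i j = R (suc i) (suc j)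

  restrict : IsEquivalenceOn P R → IsEquivalenceOn P⁺ R⁺
  restrict E = record
    { domain = domain ; reflexive = reflexive ; symmetric = symmetric ; transitive = transitive }
    where open IsEquivalenceOn E

  private
    shift-surjective : {g : Σ (Fin n) P⁺ → Fin k} (f : Σ (Fin (suc n)) P → Fin k) →
                       (∀ i p → f (suc i , p) ≡ g (i , p)) → Surjective _≡_ _≡_ g → Surjective _≡_ _≡_ f
    shift-surjective f f-suc g-surj = strictlySurjective⇒surjective λ y →
      let ((i , p) , gi≡y) = g-surj y in (suc i , p) , trans (f-suc i p) (gi≡y refl)

  skip : ¬ P zero → Classification P⁺ R⁺ k → Classification P R k
  skip ¬p₀ (g , g-surj , g-ker) = f , shift-surjective f (λ _ _ → refl) g-surj , ker
    where
    f : Σ (Fin (suc n)) P → Fin _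
    f (zero  , p) = contradiction p ¬p₀
    f (suc i , p) = g (i , p)
    ker : ∀ x y → (f x ≡ f y → R (proj₁ x) (proj₁ y)) × (R (proj₁ x) (proj₁ y) → f x ≡ f y)
    ker (zero  , p) _           = contradiction p ¬p₀
    ker (suc i , p) (zero  , q) = contradiction q ¬p₀
    ker (suc i , p) (suc j , q) = g-ker (i , p) (j , q)

  join : IsEquivalenceOn P R → ∀ j → R zero (suc j) → Classification P⁺ R⁺ k → Classification P R k
  join E j r (g , g-surj , g-ker) = f , shift-surjective f (λ _ _ → refl) g-surj , ker
    where
    open IsEquivalenceOn E
    pⱼ : P⁺ j
    pⱼ = domain (symmetric r)
    f : Σ (Fin (suc n)) P → Fin _
    f (zero  , _) = g (j , pⱼ)
    f (suc i , p) = g (i , p)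
    ker : ∀ x y → (f x ≡ f y → R (proj₁ x) (proj₁ y)) × (R (proj₁ x) (proj₁ y) → f x ≡ f y)
    ker (zero  , p) (zero  , _) = (λ _ → reflexive p) , (λ _ → refl)
    ker (zero  , _) (suc i , q) = let (⇒ , ⇐) = g-ker (j , pⱼ) (i , q) in
      (λ e → transitive r (⇒ e)) , (λ r′ → ⇐ (transitive (symmetric r) r′))
    ker (suc i , p) (zero  , _) = let (⇒ , ⇐) = g-ker (i , p) (j , pⱼ) in
      (λ e → transitive (⇒ e) (symmetric r)) , (λ r′ → ⇐ (transitive r′ r))
    ker (suc i , p) (suc i′ , q) = g-ker (i , p) (i′ , q)

  new : IsEquivalenceOn P R → P zero → (∀ j → ¬ R zero (suc j)) →
        Classification P⁺ R⁺ k → Classification P R (suc k)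
  new E p₀ apart (g , g-surj , g-ker) = f , surj , ker
    where
    open IsEquivalenceOn E
    f : Σ (Fin (suc n)) P → Fin (suc _)
    f (zero  , _) = zero
    f (suc i , p) = suc (g (i , p))
    surj : Surjective _≡_ _≡_ f
    surj = strictlySurjective⇒surjective λ
      { zero    → (zero , p₀) , refl
      ; (suc y) → let ((i , p) , gi≡y) = g-surj y in (suc i , p) , cong suc (gi≡y refl) }
    ker : ∀ x y → (f x ≡ f y → R (proj₁ x) (proj₁ y)) × (R (proj₁ x) (proj₁ y) → f x ≡ f y)
    ker (zero  , p) (zero  , _) = (λ _ → reflexive p) , (λ _ → refl)
    ker (zero  , _) (suc i , _) = (λ ()) , (λ r → contradiction r (apart i))
    ker (suc i , _) (zero  , _) = (λ ()) , (λ r → contradiction (symmetric r) (apart i))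
    ker (suc i , p) (suc j , q) = let (⇒ , ⇐) = g-ker (i , p) (j , q) in
      (⇒ ∘ suc-injective) , (cong suc ∘ ⇐)

classify : {P : Fin n → Set} {R : Fin n → Fin n → Set} →
           (∀ x → Dec (P x)) → (∀ x y → Dec (R x y)) → IsEquivalenceOn P R → ∃ (Classification P R)
classify {zero}  _  _  _ = 0 , (λ { (() , _) }) , (λ ()) , (λ { (() , _) })
classify {suc n} P? R? E with classify (P? ∘ suc) (λ i j → R? (suc i) (suc j)) (Classify.restrict E)
... | k , c with P? zero | any? (λ j → R? zero (suc j))
...   | no ¬p₀ | _              = k , Classify.skip ¬p₀ c
...   | yes _  | yes (j , r)    = k , Classify.join E j r c
...   | yes p₀ | no none-related = suc k , Classify.new E p₀ (λ j r → none-related (j , r)) c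

module _ (G : Graph n) where

  components : (S : Subset n) → (∀ x y → Dec (Reach G S x y)) → ∃ (NumComponents G S)
  components S Reach? = classify (_∈? S) Reach? record
    { domain = reach-start ; reflexive = here ; symmetric = reach-sym ; transitive = reach-trans }

  ¬¬-components : (S : Subset n) → ¬ ¬ ∃ (NumComponents G S)
  ¬¬-components S = do
    Reach? ← ¬¬-∀-Fin λ x → ¬¬-decidable (Reach G S x)
    pure (components S Reach?)

  self-cvc : {S : Subset n} → NumComponents G S k → IsCVC G S S
  self-cvc {k = k} S-comp = ((λ x∈S → x∈S) , λ _ _ x∈S _ _ → inj₁ x∈S) , k , S-comp , S-comp

  connected-by-count : {S D : Subset n} → Connected G S →
                    NumComponents G S k → NumComponents G D k → Connected G D
  connected-by-count S-conn (f , f-surj , f-ker) (g , _ , g-ker) x∈D y∈D =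
    proj₁ (g-ker (_ , x∈D) (_ , y∈D)) (single-class _ _)
    where
    single-class : ∀ i j → i ≡ j
    single-class i j =
      let (x , fx≡i) = f-surj i ; (y , fy≡j) = f-surj j in
      trans (sym (fx≡i refl)) (trans (proj₂ (f-ker x y) (S-conn (proj₂ x) (proj₂ y))) (fy≡j refl))

-- G[S] and G[S′] have the same components when S′ arises from S by contracting
-- A (each vertex of which reaches c inside S) onto the single vertex c.
module Collapse {G : Graph n} {S S′ A : Subset n} {c : Fin n}
  (S′⊆S : S′ ⊆ S) (c∈S′ : c ∈ S′)
  (kept : ∀ {x} → x ∈ S → x ∉ A → x ∈ S′)
  (merged : ∀ {x} → x ∈ S′ → x ∈ A → x ≡ c)
  (to-c : ∀ {x} → x ∈ S → x ∈ A → Reach G S x c)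
  (boundary : ∀ {x y} → x ∈ S → y ∈ S → x ∉ A → y ∈ A → adj G x y ≡ true → Reach G S′ x c)
  where

  π : Fin n → Fin n
  π x with x ∈? A
  ... | yes _ = c
  ... | no  _ = x

  π-∈ : ∀ {x} → x ∈ S → π x ∈ S′
  π-∈ {x} x∈S with x ∈? A
  ... | yes _   = c∈S′
  ... | no  x∉A = kept x∈S x∉A

  π-fix : ∀ {x} → x ∈ S′ → π x ≡ x
  π-fix {x} x∈S′ with x ∈? A
  ... | yes x∈A = sym (merged x∈S′ x∈A)
  ... | no  _   = refl

  to-π : ∀ {x} → x ∈ S → Reach G S x (π x)
  to-π {x} x∈S with x ∈? A
  ... | yes x∈A = to-c x∈S x∈A
  ... | no  _   = here x∈S

  π-edge : ∀ {x y} → x ∈ S → y ∈ S → adj G x y ≡ true → Reach G S′ (π x) (π y)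
  π-edge {x} {y} x∈S y∈S e with x ∈? A | y ∈? A
  ... | yes _   | yes _   = here c∈S′
  ... | no  x∉A | no  y∉A = edge-reach (kept x∈S x∉A) (kept y∈S y∉A) e
  ... | no  x∉A | yes y∈A = boundary x∈S y∈S x∉A y∈A e
  ... | yes x∈A | no  y∉A = reach-sym (boundary y∈S x∈S y∉A x∈A (adj-sym G e))

  reach-π : ∀ {x y} → Reach G S x y → Reach G S′ (π x) (π y)
  reach-π = reach-map π π-∈ π-edge

  reach-π⁻ : ∀ {x y} → x ∈ S → y ∈ S → Reach G S′ (π x) (π y) → Reach G S x y
  reach-π⁻ x∈S y∈S r = reach-trans (to-π x∈S) (reach-trans (reach-mono S′⊆S r) (reach-sym (to-π y∈S)))

  same-components : NumComponents G S′ k → NumComponents G S k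
  same-components (f , f-surj , f-ker) = f ∘ project , surj , ker
    where
    project : Σ (Fin n) (_∈ S) → Σ (Fin n) (_∈ S′)
    project (x , x∈S) = π x , π-∈ x∈S
    surj : Surjective _≡_ _≡_ (f ∘ project)
    surj = strictlySurjective⇒surjective λ i →
      let ((z , z∈S′) , fz≡i) = f-surj i
          πz~z = subst (λ w → Reach G S′ w z) (sym (π-fix z∈S′)) (here z∈S′)
      in (z , S′⊆S z∈S′) , trans (proj₂ (f-ker _ _) πz~z) (fz≡i refl)
    ker : ∀ x y → (f (project x) ≡ f (project y) → Reach G S (proj₁ x) (proj₁ y)) ×
                  (Reach G S (proj₁ x) (proj₁ y) → f (project x) ≡ f (project y))
    ker x y = reach-π⁻ (proj₂ x) (proj₂ y) ∘ proj₁ (f-ker (project x) (project y)) ,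
              proj₂ (f-ker (project x) (project y)) ∘ reach-π

components-≤ : ∀ {k′} {G G′ : Graph n} {S : Subset n} →
               (∀ {x y} → Reach G S x y → Reach G′ S x y) →
               NumComponents G S k → NumComponents G′ S k′ → k′ ≤ k
components-≤ {G = G} {G′} {S} G⇒G′ (f , _ , f-ker) (g , g-surj , g-ker) = injective⇒≤ h-injective
  where
  rep : ∀ i → Σ (Fin _) (_∈ S)
  rep i = proj₁ (g-surj i)
  h-injective : ∀ {i j} → f (rep i) ≡ f (rep j) → i ≡ j
  h-injective {i} {j} e = trans (sym (proj₂ (g-surj i) refl))
    (trans (proj₂ (g-ker (rep i) (rep j)) (G⇒G′ (proj₁ (f-ker (rep i) (rep j)) e))) (proj₂ (g-surj j) refl))

module _ (G : Graph n) (u v : Fin n) where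

  removeEdge-⊆ : ∀ {x y} → adj (removeEdge G u v) x y ≡ true → adj G x y ≡ true
  removeEdge-⊆ {x} {y} e with adj G x y
  ... | true = refl

  removeEdge-⊇ : ∀ {x y} → adj G x y ≡ true →
                 (x ≡ u × y ≡ v) ⊎ (x ≡ v × y ≡ u) ⊎ adj (removeEdge G u v) x y ≡ true
  removeEdge-⊇ {x} {y} e rewrite e with x ≟ u | y ≟ v | x ≟ v | y ≟ u
  ... | yes x≡u | yes y≡v | _       | _       = inj₁ (x≡u , y≡v)
  ... | _       | _       | yes x≡v | yes y≡u = inj₂ (inj₁ (x≡v , y≡u))
  ... | yes _   | no  _   | yes _   | no  _   = inj₂ (inj₂ refl)
  ... | yes _   | no  _   | no  _   | _       = inj₂ (inj₂ refl)
  ... | no  _   | _       | yes _   | no  _   = inj₂ (inj₂ refl)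
  ... | no  _   | _       | no  _   | _       = inj₂ (inj₂ refl)

  bridge-separates : IsBridge G u v → ¬ Reach (removeEdge G u v) ⊤ v u
  bridge-separates (_ , k , k′ , G-comp , G′-comp , k<k′) v~u =
    <⇒≱ k<k′ (components-≤ (reach-map (λ x → x) (λ _ → ∈⊤) reroute) G-comp G′-comp)
    where
    reroute : ∀ {x y} → x ∈ ⊤ → y ∈ ⊤ → adj G x y ≡ true → Reach (removeEdge G u v) ⊤ x y
    reroute x∈⊤ y∈⊤ e with removeEdge-⊇ e
    ... | inj₁ (refl , refl)        = reach-sym v~u
    ... | inj₂ (inj₁ (refl , refl)) = v~u
    ... | inj₂ (inj₂ e′)            = edge-reach x∈⊤ y∈⊤ e′

module Sides (G : Graph n) {u v : Fin n} (uv : adj G u v ≡ true)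
  (separated : ¬ Reach (removeEdge G u v) ⊤ v u)
  (B : Subset n) (B-spec : ∀ {x} → x ∈ B ⇔ Reach (removeEdge G u v) ⊤ v x) where

  v∈B : v ∈ B
  v∈B = from B-spec (here ∈⊤)

  u∉B : u ∉ B
  u∉B = separated ∘ to B-spec

  B-closed : ∀ {x y} → x ∈ B → adj G x y ≡ true → y ∈ B ⊎ (x ≡ v × y ≡ u)
  B-closed x∈B e with removeEdge-⊇ G u v e
  ... | inj₁ (refl , _) = contradiction x∈B u∉B
  ... | inj₂ (inj₁ vu)  = inj₂ vu
  ... | inj₂ (inj₂ e′)  = inj₁ (from B-spec (reach-trans (to B-spec x∈B) (edge-reach ∈⊤ ∈⊤ e′)))

  crossing : ∀ {x y} → x ∉ B → y ∈ B → adj G x y ≡ true → x ≡ u × y ≡ v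
  crossing x∉B y∈B e with B-closed y∈B (adj-sym G e)
  ... | inj₁ x∈B         = contradiction x∈B x∉B
  ... | inj₂ (y≡v , x≡u) = x≡u , y≡v

  data Side : Fin n → Fin n → Set where
    inner    : ∀ {x y} → x ∈ B → y ∈ B → Side x y
    outer    : ∀ {x y} → x ∉ B → y ∉ B → Side x y
    bridge   : Side u v
    bridge⁻¹ : Side v u

  side : ∀ {x y} → adj G x y ≡ true → Side x y
  side {x} {y} e with x ∈? B | y ∈? B
  ... | yes x∈B | yes y∈B = inner x∈B y∈B
  ... | no  x∉B | no  y∉B = outer x∉B y∉B
  ... | no  x∉B | yes y∈B with crossing x∉B y∈B e
  ...   | refl , refl = bridge
  side {x} {y} e | yes x∈B | no y∉B with crossing y∉B x∈B (adj-sym G e)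
  ...   | refl , refl = bridge⁻¹

  S₁ S₂ : Subset n
  S₁ = ∁ B ∪ ⁅ v ⁆
  S₂ = B ∪ ⁅ u ⁆

  ∉B⇒∈S₁ : ∀ {x} → x ∉ B → x ∈ S₁
  ∉B⇒∈S₁ x∉B = x∈p∪q⁺ (inj₁ (x∉p⇒x∈∁p x∉B))

  v∈S₁ : v ∈ S₁
  v∈S₁ = x∈p∪q⁺ (inj₂ (x∈⁅x⁆ v))

  ∈S₁∩B⇒≡v : ∀ {x} → x ∈ S₁ → x ∈ B → x ≡ v
  ∈S₁∩B⇒≡v x∈S₁ x∈B with x∈p∪q⁻ (∁ B) ⁅ v ⁆ x∈S₁
  ... | inj₁ x∈∁B = contradiction x∈B (x∈∁p⇒x∉p x∈∁B)
  ... | inj₂ x∈⁅v⁆ = x∈⁅y⁆⇒x≡y v x∈⁅v⁆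

  B⊆S₂ : B ⊆ S₂
  B⊆S₂ x∈B = x∈p∪q⁺ (inj₁ x∈B)

  u∈S₂ : u ∈ S₂
  u∈S₂ = x∈p∪q⁺ (inj₂ (x∈⁅x⁆ u))

  ∈S₂∖B⇒≡u : ∀ {x} → x ∈ S₂ → x ∉ B → x ≡ u
  ∈S₂∖B⇒≡u x∈S₂ x∉B with x∈p∪q⁻ B ⁅ u ⁆ x∈S₂
  ... | inj₁ x∈B   = contradiction x∈B x∉B
  ... | inj₂ x∈⁅u⁆ = x∈⁅y⁆⇒x≡y u x∈⁅u⁆

  v-neighbour∈B : ∀ {b} → adj G v b ≡ true → b ≢ u → b ∈ B
  v-neighbour∈B vb b≢u with B-closed v∈B vb
  ... | inj₁ b∈B       = b∈B
  ... | inj₂ (_ , b≡u) = contradiction b≡u b≢u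

  v-neighbour∉S₁ : ∀ {b} → adj G v b ≡ true → b ≢ u → b ∉ S₁
  v-neighbour∉S₁ vb b≢u b∈S₁ =
    adj-irrefl G (subst (λ w → adj G v w ≡ true) (∈S₁∩B⇒≡v b∈S₁ (v-neighbour∈B vb b≢u)) vb)

  u-neighbour∉S₂ : ∀ {a} → adj G u a ≡ true → a ≢ v → a ∉ S₂
  u-neighbour∉S₂ {a} ua a≢v a∈S₂ with a ∈? B
  ... | yes a∈B = a≢v (proj₂ (crossing u∉B a∈B ua))
  ... | no  a∉B = adj-irrefl G (subst (λ w → adj G u w ≡ true) (∈S₂∖B⇒≡u a∈S₂ a∉B) ua)

  cover-S₁ : ∀ {C} → IsVC G ⊤ C → u ∈ C → IsVC G S₁ (C ∩ ∁ B)
  cover-S₁ {C} (_ , C-covers) u∈C = ∉B⇒∈S₁ ∘ x∈∁p⇒x∉p ∘ proj₂ ∘ x∈p∩q⁻ C (∁ B) , covers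
    where
    covers : ∀ x y → x ∈ S₁ → y ∈ S₁ → adj G x y ≡ true → x ∈ C ∩ ∁ B ⊎ y ∈ C ∩ ∁ B
    covers x y x∈S₁ y∈S₁ e with side e
    ... | bridge   = inj₁ (x∈p∩q⁺ (u∈C , x∉p⇒x∈∁p u∉B))
    ... | bridge⁻¹ = inj₂ (x∈p∩q⁺ (u∈C , x∉p⇒x∈∁p u∉B))
    ... | inner x∈B y∈B = contradiction (subst₂ (λ x y → adj G x y ≡ true)
                            (∈S₁∩B⇒≡v x∈S₁ x∈B) (∈S₁∩B⇒≡v y∈S₁ y∈B) e) (adj-irrefl G)
    ... | outer x∉B y∉B with C-covers x y ∈⊤ ∈⊤ e
    ...   | inj₁ x∈C = inj₁ (x∈p∩q⁺ (x∈C , x∉p⇒x∈∁p x∉B))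
    ...   | inj₂ y∈C = inj₂ (x∈p∩q⁺ (y∈C , x∉p⇒x∈∁p y∉B))

  cover-S₂ : ∀ {C} → IsVC G ⊤ C → v ∈ C → IsVC G S₂ (C ∩ B)
  cover-S₂ {C} (_ , C-covers) v∈C = B⊆S₂ ∘ proj₂ ∘ x∈p∩q⁻ C B , covers
    where
    covers : ∀ x y → x ∈ S₂ → y ∈ S₂ → adj G x y ≡ true → x ∈ C ∩ B ⊎ y ∈ C ∩ B
    covers x y x∈S₂ y∈S₂ e with side e
    ... | bridge   = inj₂ (x∈p∩q⁺ (v∈C , v∈B))
    ... | bridge⁻¹ = inj₁ (x∈p∩q⁺ (v∈C , v∈B))
    ... | outer x∉B y∉B = contradiction (subst₂ (λ x y → adj G x y ≡ true)
                            (∈S₂∖B⇒≡u x∈S₂ x∉B) (∈S₂∖B⇒≡u y∈S₂ y∉B) e) (adj-irrefl G)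
    ... | inner x∈B y∈B with C-covers x y ∈⊤ ∈⊤ e
    ...   | inj₁ x∈C = inj₁ (x∈p∩q⁺ (x∈C , x∈B))
    ...   | inj₂ y∈C = inj₂ (x∈p∩q⁺ (y∈C , y∈B))

  B-walk : ∀ {x y} → Reach (removeEdge G u v) ⊤ x y → x ∈ B → Reach G B x y
  B-walk (here _)     x∈B = here x∈B
  B-walk (step _ e r) x∈B = step x∈B (removeEdge-⊆ G u v e) (B-walk r y∈B)
    where y∈B = from B-spec (reach-trans (to B-spec x∈B) (edge-reach ∈⊤ ∈⊤ e))

  B-reach-v : ∀ {x} → x ∈ B → Reach G B x v
  B-reach-v x∈B = reach-sym (B-walk (to B-spec x∈B) v∈B)

  S₂-connected : Connected G S₂
  S₂-connected x∈S₂ y∈S₂ = reach-trans (to-v x∈S₂) (reach-sym (to-v y∈S₂))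
    where
    to-v : ∀ {x} → x ∈ S₂ → Reach G S₂ x v
    to-v {x} x∈S₂ with x ∈? B
    ... | yes x∈B = reach-mono B⊆S₂ (B-reach-v x∈B)
    ... | no  x∉B rewrite ∈S₂∖B⇒≡u x∈S₂ x∉B = edge-reach u∈S₂ (B⊆S₂ v∈B) uv

  G-components : NumComponents G S₁ k → NumComponents G ⊤ k
  G-components = Collapse.same-components (λ _ → ∈⊤) v∈S₁ (λ _ → ∉B⇒∈S₁) ∈S₁∩B⇒≡v
    (λ _ → reach-mono (λ _ → ∈⊤) ∘ B-reach-v) boundary
    where
    boundary : ∀ {x y} → x ∈ ⊤ → y ∈ ⊤ → x ∉ B → y ∈ B → adj G x y ≡ true → Reach G S₁ x v
    boundary _ _ x∉B y∈B e with crossing x∉B y∈B e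
    ... | refl , refl = edge-reach (∉B⇒∈S₁ u∉B) v∈S₁ uv

  module Glue {b : Fin n} (vb : adj G v b ≡ true) (b≢u : b ≢ u)
    {D₁ D₂ : Subset n} {k₁ k₂ : ℕ}
    (D₁-vc : IsVC G S₁ D₁) (S₁-comp : NumComponents G S₁ k₁) (D₁-comp : NumComponents G D₁ k₁)
    (D₂-vc : IsVC G S₂ D₂) (S₂-comp : NumComponents G S₂ k₂) (D₂-comp : NumComponents G D₂ k₂)
    where

    D₂-connected : Connected G D₂
    D₂-connected = connected-by-count G S₂-connected S₂-comp D₂-comp

    walk-from-u : ∀ {y} → Reach G D₂ u y → y ∈ B → v ∈ D₂
    walk-from-u (here _) u∈B = contradiction u∈B u∉B
    walk-from-u (step {w = w} _ e r) _ with w ∈? B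
    ... | yes w∈B with crossing u∉B w∈B e
    ...   | _ , refl = reach-start r
    walk-from-u (step {w = w} _ e r) _ | no w∉B =
      contradiction (subst (λ x → adj G u x ≡ true) (∈S₂∖B⇒≡u (proj₁ D₂-vc (reach-start r)) w∉B) e)
                    (adj-irrefl G)

    v∈D₂ : v ∈ D₂
    v∈D₂ with v ∈? D₂
    ... | yes v∈D₂ = v∈D₂
    ... | no  v∉D₂ = walk-from-u (D₂-connected u∈D₂ b∈D₂) b∈B
      where
      b∈B = v-neighbour∈B vb b≢u
      u∈D₂ : u ∈ D₂
      u∈D₂ with proj₂ D₂-vc u v u∈S₂ (B⊆S₂ v∈B) uv
      ... | inj₁ u∈D₂ = u∈D₂
      ... | inj₂ v∈D₂ = contradiction v∈D₂ v∉D₂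
      b∈D₂ : b ∈ D₂
      b∈D₂ with proj₂ D₂-vc v b (B⊆S₂ v∈B) (B⊆S₂ b∈B) vb
      ... | inj₁ v∈D₂ = contradiction v∈D₂ v∉D₂
      ... | inj₂ b∈D₂ = b∈D₂

    -- Contracting u onto v turns walks in G[D₂] into walks in G[D₂ ∩ B].
    D₂∩B-reach-v : ∀ {x} → x ∈ D₂ → x ∈ B → Reach G (D₂ ∩ B) x v
    D₂∩B-reach-v x∈D₂ x∈B = subst₂ (Reach G (D₂ ∩ B)) (π-fix x∈D₂∩B) (π-fix v∈D₂∩B)
                              (reach-π (D₂-connected x∈D₂ v∈D₂))
      where
      v∈D₂∩B = x∈p∩q⁺ (v∈D₂ , v∈B)
      x∈D₂∩B = x∈p∩q⁺ (x∈D₂ , x∈B)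
      boundary : ∀ {x y} → x ∈ D₂ → y ∈ D₂ → x ∉ ∁ B → y ∈ ∁ B → adj G x y ≡ true →
                 Reach G (D₂ ∩ B) x v
      boundary _ _ x∉∁B y∈∁B e with crossing (x∈∁p⇒x∉p y∈∁B) (x∉∁p⇒x∈p x∉∁B) (adj-sym G e)
      ... | refl , refl = here v∈D₂∩B
      open Collapse {S = D₂} {D₂ ∩ B} {∁ B} (proj₁ ∘ x∈p∩q⁻ D₂ B) v∈D₂∩B
        (λ y∈D₂ y∉∁B → x∈p∩q⁺ (y∈D₂ , x∉∁p⇒x∈p y∉∁B))
        (λ y∈D₂∩B y∈∁B → contradiction (proj₂ (x∈p∩q⁻ D₂ B y∈D₂∩B)) (x∈∁p⇒x∉p y∈∁B))
        (λ y∈D₂ _ → D₂-connected y∈D₂ v∈D₂) boundary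

    D : Subset n
    D = (D₁ ∩ ∁ B) ∪ (D₂ ∩ B)

    ∈D⁻ : ∀ {x} → x ∈ D → (x ∈ D₁ × x ∉ B) ⊎ (x ∈ D₂ × x ∈ B)
    ∈D⁻ x∈D with x∈p∪q⁻ (D₁ ∩ ∁ B) (D₂ ∩ B) x∈D
    ... | inj₁ x∈D₁∖B = let (x∈D₁ , x∈∁B) = x∈p∩q⁻ D₁ (∁ B) x∈D₁∖B in inj₁ (x∈D₁ , x∈∁p⇒x∉p x∈∁B)
    ... | inj₂ x∈D₂∩B = inj₂ (x∈p∩q⁻ D₂ B x∈D₂∩B)

    ∈D⁺ˡ : ∀ {x} → x ∈ D₁ → x ∉ B → x ∈ D
    ∈D⁺ˡ x∈D₁ x∉B = x∈p∪q⁺ (inj₁ (x∈p∩q⁺ (x∈D₁ , x∉p⇒x∈∁p x∉B)))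

    ∈D⁺ʳ : ∀ {x} → x ∈ D₂ → x ∈ B → x ∈ D
    ∈D⁺ʳ x∈D₂ x∈B = x∈p∪q⁺ (inj₂ (x∈p∩q⁺ (x∈D₂ , x∈B)))

    D₁⊆D : D₁ ⊆ D
    D₁⊆D {x} x∈D₁ with x ∈? B
    ... | no  x∉B = ∈D⁺ˡ x∈D₁ x∉B
    ... | yes x∈B rewrite ∈S₁∩B⇒≡v (proj₁ D₁-vc x∈D₁) x∈B = ∈D⁺ʳ v∈D₂ v∈B

    D∖B⊆D₁ : ∀ {x} → x ∈ D → x ∉ B → x ∈ D₁
    D∖B⊆D₁ x∈D x∉B with ∈D⁻ x∈D
    ... | inj₁ (x∈D₁ , _) = x∈D₁
    ... | inj₂ (_ , x∈B)  = contradiction x∈B x∉B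

    D∩B-reach-v : ∀ {x} → x ∈ D → x ∈ B → Reach G D x v
    D∩B-reach-v x∈D x∈B with ∈D⁻ x∈D
    ... | inj₁ (_ , x∉B)  = contradiction x∈B x∉B
    ... | inj₂ (x∈D₂ , _) = reach-mono D₂∩B⊆D (D₂∩B-reach-v x∈D₂ x∈B)
      where
      D₂∩B⊆D : D₂ ∩ B ⊆ D
      D₂∩B⊆D y∈D₂∩B = let (y∈D₂ , y∈B) = x∈p∩q⁻ D₂ B y∈D₂∩B in ∈D⁺ʳ y∈D₂ y∈B

    ∣D∣≤∣D₁∣+∣D₂∣ : ∣ D ∣ ≤ ∣ D₁ ∣ + ∣ D₂ ∣
    ∣D∣≤∣D₁∣+∣D₂∣ = ≤-trans (∣p∪q∣≤∣p∣+∣q∣ (D₁ ∩ ∁ B) (D₂ ∩ B))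
                            (+-mono-≤ (∣p∩q∣≤∣p∣ D₁ (∁ B)) (∣p∩q∣≤∣p∣ D₂ B))

    D-covers : IsVC G ⊤ D
    D-covers = (λ _ → ∈⊤) , covers
      where
      covers : ∀ x y → x ∈ ⊤ → y ∈ ⊤ → adj G x y ≡ true → x ∈ D ⊎ y ∈ D
      covers x y _ _ e with side e
      ... | bridge   = inj₂ (∈D⁺ʳ v∈D₂ v∈B)
      ... | bridge⁻¹ = inj₁ (∈D⁺ʳ v∈D₂ v∈B)
      ... | outer x∉B y∉B with proj₂ D₁-vc x y (∉B⇒∈S₁ x∉B) (∉B⇒∈S₁ y∉B) e
      ...   | inj₁ x∈D₁ = inj₁ (∈D⁺ˡ x∈D₁ x∉B)
      ...   | inj₂ y∈D₁ = inj₂ (∈D⁺ˡ y∈D₁ y∉B)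
      covers x y _ _ e | inner x∈B y∈B with proj₂ D₂-vc x y (B⊆S₂ x∈B) (B⊆S₂ y∈B) e
      ...   | inj₁ x∈D₂ = inj₁ (∈D⁺ʳ x∈D₂ x∈B)
      ...   | inj₂ y∈D₂ = inj₂ (∈D⁺ʳ y∈D₂ y∈B)

    -- D ∩ B is contracted onto v when v ∈ D₁, and onto u otherwise.
    D-components : NumComponents G D k₁
    D-components with v ∈? D₁
    ... | yes v∈D₁ = Collapse.same-components D₁⊆D v∈D₁ D∖B⊆D₁ (∈S₁∩B⇒≡v ∘ proj₁ D₁-vc) D∩B-reach-v
                       boundary D₁-comp
      where
      boundary : ∀ {x y} → x ∈ D → y ∈ D → x ∉ B → y ∈ B → adj G x y ≡ true → Reach G D₁ x v
      boundary x∈D _ x∉B y∈B e with crossing x∉B y∈B e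
      ... | refl , refl = edge-reach (D∖B⊆D₁ x∈D x∉B) v∈D₁ uv
    ... | no v∉D₁ = Collapse.same-components D₁⊆D u∈D₁ D∖B⊆D₁
        (λ x∈D₁ x∈B → contradiction (subst (_∈ D₁) (∈S₁∩B⇒≡v (proj₁ D₁-vc x∈D₁) x∈B) x∈D₁) v∉D₁)
        (λ x∈D x∈B → reach-trans (D∩B-reach-v x∈D x∈B)
                       (edge-reach (∈D⁺ʳ v∈D₂ v∈B) (D₁⊆D u∈D₁) (adj-sym G uv)))
        boundary D₁-comp
      where
      u∈D₁ : u ∈ D₁
      u∈D₁ with proj₂ D₁-vc u v (∉B⇒∈S₁ u∉B) v∈S₁ uv
      ... | inj₁ u∈D₁ = u∈D₁
      ... | inj₂ v∈D₁ = contradiction v∈D₁ v∉D₁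
      boundary : ∀ {x y} → x ∈ D → y ∈ D → x ∉ B → y ∈ B → adj G x y ≡ true → Reach G D₁ x u
      boundary _ _ x∉B y∈B e with crossing x∉B y∈B e
      ... | refl , _ = here u∈D₁

    glued-cover : IsCVC G ⊤ D
    glued-cover = D-covers , k₁ , G-components S₁-comp , D-components

cheaper-parts-sum-< : ∀ {T Tc t₁ t₂ c₁ c₂} →
                      c₁ * T < Tc * t₁ → c₂ * T < Tc * t₂ → t₁ + t₂ ≤ T → c₁ + c₂ < Tc
cheaper-parts-sum-< {T} {Tc} {t₁} {t₂} {c₁} {c₂} part₁ part₂ t₁+t₂≤T =
  *-cancelʳ-< T (c₁ + c₂) Tc (begin-strict
  (c₁ + c₂) * T     ≡⟨ *-distribʳ-+ T c₁ c₂ ⟩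
  c₁ * T + c₂ * T   <⟨ +-mono-< part₁ part₂ ⟩
  Tc * t₁ + Tc * t₂ ≡⟨ sym (*-distribˡ-+ Tc t₁ t₂) ⟩
  Tc * (t₁ + t₂)    ≤⟨ *-monoʳ-≤ Tc t₁+t₂≤T ⟩
  Tc * T            ∎)
  where open ≤-Reasoning

OtherNeighbour : Graph n → Fin n → Fin n → Fin n → Set
OtherNeighbour G x y w = adj G x w ≡ true × w ≢ y

otherNeighbour? : (G : Graph n) (x y w : Fin n) → Dec (OtherNeighbour G x y w)
otherNeighbour? G x y w = (adj G x w ≟ᵇ true) ×-dec ¬? (w ≟ y)

pendant-edge : (G : Graph n) {C : Subset n} → IsMinVC G ⊤ C → ∀ {p q} → adj G p q ≡ true →
               ¬ ∃ (OtherNeighbour G p q) → ¬ (p ∈ C × q ∈ C)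
pendant-edge G {C} (C-vc , C-min) {p} {q} pq pendant (p∈C , q∈C) =
  <⇒≱ (x∈p⇒∣p-x∣<∣p∣ p∈C) (C-min (C - p) ((λ _ → ∈⊤) , covers))
  where
  q∈C-p : q ∈ C - p
  q∈C-p = x∈p∧x≢y⇒x∈p-y q∈C λ { refl → adj-irrefl G pq }
  relieve : ∀ {x y} → x ∈ C → adj G x y ≡ true → x ∈ C - p ⊎ y ∈ C - p
  relieve {x} {y} x∈C e with x ≟ p
  ... | no x≢p = inj₁ (x∈p∧x≢y⇒x∈p-y x∈C x≢p)
  ... | yes refl with y ≟ q
  ...   | yes refl = inj₂ q∈C-p
  ...   | no  y≢q  = contradiction (y , e , y≢q) pendant
  covers : ∀ x y → x ∈ ⊤ → y ∈ ⊤ → adj G x y ≡ true → x ∈ C - p ⊎ y ∈ C - p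
  covers x y _ _ e with proj₂ C-vc x y ∈⊤ ∈⊤ e
  ... | inj₁ x∈C = relieve x∈C e
  ... | inj₂ y∈C = swap (relieve y∈C (adj-sym G e))

¬¬-non-pendant-bridge : {G : Graph n} {C : Subset n} {u v : Fin n} →
  Critical G → IsMinVC G ⊤ C → IsBridge G u v → u ∈ C → v ∈ C →
  ∃ (OtherNeighbour G u v) → ∃ (OtherNeighbour G v u) → ¬ ¬ ⊥
¬¬-non-pendant-bridge {G = G} {C} {u} {v} (_ , cheaper) C-min bridge@(uv , _ , _ , G-comp , _) u∈C v∈C
  (a , ua , a≢v) (b , vb , b≢u) = do
  (B , B-spec) ← ¬¬-subset (Reach (removeEdge G u v) ⊤ v)
  let open Sides G uv (bridge-separates G u v bridge) B B-spec
  (_ , S₁-comp) ← ¬¬-components G S₁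
  (_ , S₂-comp) ← ¬¬-components G S₂
  (t₁ , τ₁ , t₁≤) ← ¬¬-τ G S₁ (cover-S₁ (proj₁ C-min) u∈C)
  (t₂ , τ₂ , t₂≤) ← ¬¬-τ G S₂ (cover-S₂ (proj₁ C-min) v∈C)
  (_ , τc₁@(D₁ , ((D₁-vc , _ , S₁-comp′ , D₁-comp) , _) , refl) , _) ← ¬¬-τc G S₁ (self-cvc G S₁-comp)
  (_ , τc₂@(D₂ , ((D₂-vc , _ , S₂-comp′ , D₂-comp) , _) , refl) , _) ← ¬¬-τc G S₂ (self-cvc G S₂-comp)
  (_ , τc@(_ , (_ , D-min) , refl) , _) ← ¬¬-τc G ⊤ (self-cvc G G-comp)
  let open Glue vb b≢u D₁-vc S₁-comp′ D₁-comp D₂-vc S₂-comp′ D₂-comp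
      τ = C , C-min , refl
      uv∈S₁ = u , v , ∉B⇒∈S₁ u∉B , v∈S₁ , uv
      uv∈S₂ = u , v , u∈S₂ , B⊆S₂ v∈B , uv
      part₁ = cheaper S₁ (b , v-neighbour∉S₁ vb b≢u) uv∈S₁ _ _ _ _ τ₁ τc₁ τ τc
      part₂ = cheaper S₂ (a , u-neighbour∉S₂ ua a≢v) uv∈S₂ _ _ _ _ τ₂ τc₂ τ τc
      t₁+t₂≤∣C∣ = ≤-trans (+-mono-≤ t₁≤ t₂≤)
                    (≤-reflexive (trans (+-comm ∣ C ∩ ∁ B ∣ ∣ C ∩ B ∣) (∣p∩q∣+∣p∩∁q∣≡∣p∣ C B)))
  pure (<⇒≱ (cheaper-parts-sum-< {c₁ = ∣ D₁ ∣} {∣ D₂ ∣} part₁ part₂ t₁+t₂≤∣C∣)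
            (≤-trans (D-min D glued-cover) ∣D∣≤∣D₁∣+∣D₂∣))

lemma6 : ∀ {n : ℕ} (G : Graph n) → Critical G →
    ∀ (C : Subset n) → IsMinVC G ⊤ C →
    ∀ (u v : Fin n) → IsBridge G u v → ¬ (u ∈ C × v ∈ C)
lemma6 G critical C C-min u v bridge (u∈C , v∈C)
  with any? (otherNeighbour? G u v) | any? (otherNeighbour? G v u)
... | no u-pendant | _            = pendant-edge G C-min (proj₁ bridge) u-pendant (u∈C , v∈C)
... | _            | no v-pendant = pendant-edge G C-min (adj-sym G (proj₁ bridge)) v-pendant (v∈C , u∈C)
... | yes a        | yes b        = ¬¬-non-pendant-bridge critical C-min bridge u∈C v∈C a b (λ ())
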